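{- For every even integer $g\ge4$ there are infinitely many primitive numbers (with respect to $g$).
   Context: Fix an even integer $g\ge4$. For an odd integer $m\ge1$, an extreme cycle for the digit set $\{0,m\}$ is a finite set of distinct integers $\{x_0,\dots,x_{r-1}\}$ together with digits $l_0,\dots,l_{r-1}\in\{0,m\}$ such that $x_{j+1}=(x_j+l_j)/g$ for $0\le j\le r-2$ and $x_0=(x_{r-1}+l_{r-1})/g$. The cycle $\{0\}$ (with digit $0$) is the trivial extreme cycle. The odd number $m$ is complete if the only extreme cycle for $\{0,m\}$ is the trivial one, and incomplete otherwise. An odd number $m$ is primitive if it is incomplete and every proper divisor $d$ of $m$ is complete. -}

module Defs where

open import Data.Nat using (ℕ; zero; suc; _≤_; _%_)
open import Data.Nat.Divisibility using (_∣_)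
open import Data.Integer using (ℤ; +_) renaming (_+_ to _+ℤ_; _*_ to _*ℤ_)
open import Data.Fin using (Fin; zero; suc; inject₁; fromℕ)
open import Data.Sum using (_⊎_)
open import Data.Product using (Σ; ∃; _×_)
open import Relation.Binary.PropositionalEquality using (_≡_; _≢_)
open import Relation.Nullary using (¬_)
open import Function.Definitions using (Injective)

-- It has length (suc r); elements x₀ … x_r (pairwise distinct), digits l₀ … l_r ∈ {0,m},
-- with x_{j+1} = (x_j + l_j)/g  (written g·x_{j+1} = x_j + l_j, i.e. exact division)
-- and x_0 = (x_r + l_r)/g.
record ExtremeCycle (g m : ℕ) : Set where
  field
    r        : ℕ
    x        : Fin (suc r) → ℤ
    l        : Fin (suc r) → ℤ
    distinct : Injective _≡_ _≡_ x
    digits   : ∀ j → (l j ≡ + 0) ⊎ (l j ≡ + m)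
    step     : ∀ (j : Fin r) → (+ g) *ℤ x (suc j) ≡ x (inject₁ j) +ℤ l (inject₁ j)
    wrap     : (+ g) *ℤ x zero ≡ x (fromℕ r) +ℤ l (fromℕ r)

Trivial : ∀ {g m} → ExtremeCycle g m → Set
Trivial C = ∀ j → ExtremeCycle.x C j ≡ + 0

Odd : ℕ → Set
Odd m = m % 2 ≡ 1

Complete : ℕ → ℕ → Set
Complete g m = ∀ (C : ExtremeCycle g m) → Trivial C

Incomplete : ℕ → ℕ → Set
Incomplete g m = Σ (ExtremeCycle g m) (λ C → ¬ Trivial C)

Primitive : ℕ → ℕ → Set
Primitive g m = Odd m × Incomplete g m × (∀ d → d ∣ m → d ≢ m → Complete g d)

module Submission where

-- Write g = h + 1 and let G r = 1 + g + ⋯ + g^(r-1) be the base-g repunit.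
-- Given N we take K = N + h and M = G (K! + 1), and show:
--   (1) M is odd and incomplete: an explicit cycle of the "digit map"
--       v ↦ (v + l)/g (l ∈ {0, M} the unique digit making this integral)
--       passes through a positive number;
--   (2) every divisor e > 1 of M exceeds K, since the period of g modulo e
--       divides K!, which forces e ∣ K! + 1 and e ∣ K!;
--   (3) the least incomplete divisor of M is primitive, and it is > 1
--       because 1 is complete for g ≥ 4; by (2) it is ≥ N.
-- Step (3) needs completeness to be decidable.  This rests on the digit map:
-- the extreme cycles for {0, d} are exactly its cycles, all their elements
-- lie in [0, d], so a nontrivial one exists iff some 1 ≤ a ≤ d returns to
-- itself within d + 1 steps.

open import Defs
open import Data.Nat
open import Data.Nat.Properties
open import Data.Nat.Induction using (<-rec)
open import Data.Nat.Divisibility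
open import Data.Nat.DivMod using (_%_; _/_; m≡m%n+[m/n]*n; m%n<n; [m+kn]%n≡m%n)
open import Data.Nat.Coprimality using (Coprime; coprime-divisor)
open import Data.Nat.Solver using (module +-*-Solver)
open import Data.Integer using (ℤ; +_; -[1+_]; -<-)
  renaming (_+_ to _+ℤ_; _*_ to _*ℤ_; _≤_ to _≤ℤ_; _<_ to _<ℤ_)
import Data.Integer.Properties as ℤ
open import Data.Fin using (Fin; zero; suc; toℕ; inject₁; fromℕ; fromℕ<)
import Data.Fin.Properties as Fin
open import Data.Maybe using (Maybe; just; nothing; _>>=_; fromMaybe)
import Data.Maybe.Properties as Maybe
open import Data.Product using (∃; _×_; _,_; proj₁; proj₂)
open import Data.Sum using (_⊎_; inj₁; inj₂)
open import Data.Empty using (⊥-elim)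
open import Function using (_∘_)
open import Function.Definitions using (Injective)
open import Relation.Binary.Bundles using (TotalPreorder)
open import Relation.Binary.Definitions using (DecidableEquality; tri<; tri≈; tri>)
import Relation.Binary.Construct.Flip.EqAndOrd as Flip
open import Relation.Binary.PropositionalEquality
open import Relation.Nullary using (¬_; Dec; yes; no)
open import Relation.Nullary.Decidable using (_×-dec_)
open import Relation.Unary using (Decidable)

odd⇒¬even : ∀ {m} → Odd m → ¬ 2 ∣ m
odd⇒¬even {m} m-odd 2∣m with trans (sym (n∣m⇒m%n≡0 m 2 2∣m)) m-odd
... | ()

odd-divisor : ∀ {d m} → d ∣ m → Odd m → Odd d
odd-divisor {d} d∣m m-odd with d % 2 in eq | m%n<n d 2
... | 1 | _ = refl
... | suc (suc _) | s≤s (s≤s ())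
... | 0 | _ = ⊥-elim (odd⇒¬even m-odd (∣-trans (m%n≡0⇒n∣m d 2 eq) d∣m))

least-witness : {P : ℕ → Set} → Decidable P → ∀ {k} → P k →
  ∃ λ t → P t × (∀ s → s < t → ¬ P s)
least-witness {P} P? {k} = <-rec (λ k → P k → ∃ λ t → P t × (∀ s → s < t → ¬ P s)) search k
  where
  search : ∀ k → (∀ {j} → j < k → P j → ∃ λ t → P t × (∀ s → s < t → ¬ P s)) →
           P k → ∃ λ t → P t × (∀ s → s < t → ¬ P s)
  search k smaller pk with anyUpTo? P? k
  ... | yes (j , j<k , pj) = smaller j<k pj
  ... | no none = k , pk , λ s s<k ps → none (s , s<k , ps)

module _ {c ℓ₁ ℓ₂} (O : TotalPreorder c ℓ₁ ℓ₂) where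
  open TotalPreorder O using (Carrier; _≲_; total) renaming (refl to ≲-refl; trans to ≲-trans)

  argmax : ∀ {n} (F : Fin (suc n) → Carrier) → ∃ λ j → ∀ i → F i ≲ F j
  argmax {zero} F = zero , λ { zero → ≲-refl }
  argmax {suc n} F with argmax (F ∘ suc)
  ... | j , below with total (F zero) (F (suc j))
  ...   | inj₁ le = suc j , λ { zero → le ; (suc i) → below i }
  ...   | inj₂ ge = zero , λ { zero → ≲-refl ; (suc i) → ≲-trans (below i) ge }

module PartialIteration {A : Set} (f : A → Maybe A) where

  iter : ℕ → A → Maybe A
  iter zero v = just v
  iter (suc k) v = f v >>= iter k

  iter-+ : ∀ a b v → iter (a + b) v ≡ (iter a v >>= iter b)
  iter-+ zero b v = refl
  iter-+ (suc a) b v with f v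
  ... | nothing = refl
  ... | just u = iter-+ a b u

  iter-suc : ∀ t v → iter (suc t) v ≡ (iter t v >>= f)
  iter-suc zero v with f v
  ... | nothing = refl
  ... | just u = refl
  iter-suc (suc t) v with f v
  ... | nothing = refl
  ... | just u = iter-suc t u

  iter-shift : ∀ a m {v u} → iter a v ≡ just u → iter (a + m) v ≡ iter m u
  iter-shift a m {v} eq rewrite iter-+ a m v | eq = refl

  iter-prefix : ∀ a {b v w} → iter (a + b) v ≡ just w → ∃ λ u → iter a v ≡ just u
  iter-prefix zero {v = v} eq = v , refl
  iter-prefix (suc a) {v = v} eq with f v
  ... | just u = iter-prefix a eq
  ... | nothing with eq
  ...   | ()

  iter-chain : ∀ k (y : ℕ → A) → (∀ i → i < k → f (y i) ≡ just (y (suc i))) → iter k (y 0) ≡ just (y k)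
  iter-chain zero y steps = refl
  iter-chain (suc k) y steps rewrite steps 0 z<s = iter-chain k (y ∘ suc) (λ i i<k → steps (suc i) (s<s i<k))

  iter-along : ∀ {r} (z : Fin (suc r) → A) → (∀ (j : Fin r) → f (z (inject₁ j)) ≡ just (z (suc j))) →
               ∀ j → iter (toℕ j) (z zero) ≡ just (z j)
  iter-along z steps zero = refl
  iter-along {suc r} z steps (suc j) rewrite steps zero = iter-along (z ∘ suc) (steps ∘ suc) j

  record Cycle (n : A) : Set where
    field
      r        : ℕ
      point    : Fin (suc r) → A
      starts   : point zero ≡ n
      distinct : Injective _≡_ _≡_ point
      step     : ∀ (j : Fin r) → f (point (inject₁ j)) ≡ just (point (suc j))
      wrap     : f (point (fromℕ r)) ≡ just (point zero)

  module _ {n : A} (C : Cycle n) where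
    open Cycle C

    cycle-orbit : ∀ j → iter (toℕ j) n ≡ just (point j)
    cycle-orbit j = subst (λ v → iter (toℕ j) v ≡ just (point j)) starts (iter-along point step j)

    cycle⇒periodic : iter (suc r) n ≡ just n
    cycle⇒periodic = begin
      iter (suc r) n                 ≡⟨ iter-suc r n ⟩
      (iter r n >>= f)               ≡⟨ cong (λ k → iter k n >>= f) (sym (Fin.toℕ-fromℕ r)) ⟩
      (iter (toℕ (fromℕ r)) n >>= f) ≡⟨ cong (_>>= f) (cycle-orbit (fromℕ r)) ⟩
      f (point (fromℕ r))            ≡⟨ trans wrap (cong just starts) ⟩
      just n                         ∎
      where open ≡-Reasoning

  -- Conversely a periodic point lies on a cycle: cut its orbit at the least period.
  module _ (_≟_ : DecidableEquality A) {n : A} {k : ℕ} (periodic : iter (suc k) n ≡ just n) where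

    Returns : ℕ → Set
    Returns t = iter (suc t) n ≡ just n

    least-period : ∃ λ t → Returns t × (∀ s → s < t → ¬ Returns s)
    least-period = least-witness (λ t → Maybe.≡-dec _≟_ (iter (suc t) n) (just n)) {k} periodic

    t₀ : ℕ
    t₀ = proj₁ least-period

    returns : Returns t₀
    returns = proj₁ (proj₂ least-period)

    orbit : ℕ → A
    orbit j = fromMaybe n (iter j n)

    orbit-defined : ∀ j → j ≤ suc t₀ → iter j n ≡ just (orbit j)
    orbit-defined j j≤ with iter-prefix j (subst (λ m → iter m n ≡ just n) (sym (m+[n∸m]≡n j≤)) returns)
    ... | _ , defined rewrite defined = refl

    -- Equal points before the least period would give an earlier return.
    orbit-injective : ∀ {a b} → a < b → b ≤ t₀ → orbit a ≢ orbit b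
    orbit-injective {a} {b} a<b b≤t₀ same = proj₂ (proj₂ least-period) (a + (t₀ ∸ b)) earlier early-return
      where
      rest : ℕ
      rest = suc (t₀ ∸ b)
      earlier : a + (t₀ ∸ b) < t₀
      earlier = ≤-trans (+-monoˡ-< (t₀ ∸ b) a<b) (≤-reflexive (m+[n∸m]≡n b≤t₀))
      early-return : Returns (a + (t₀ ∸ b))
      early-return = begin
        iter (suc (a + (t₀ ∸ b))) n ≡⟨ cong (λ m → iter m n) (sym (+-suc a (t₀ ∸ b))) ⟩
        iter (a + rest) n           ≡⟨ iter-shift a rest (orbit-defined a (≤-trans (<⇒≤ a<b) (m≤n⇒m≤1+n b≤t₀))) ⟩
        iter rest (orbit a)         ≡⟨ cong (iter rest) same ⟩
        iter rest (orbit b)         ≡⟨ sym (iter-shift b rest (orbit-defined b (m≤n⇒m≤1+n b≤t₀))) ⟩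
        iter (b + rest) n           ≡⟨ cong (λ m → iter m n) (trans (+-suc b (t₀ ∸ b)) (cong suc (m+[n∸m]≡n b≤t₀))) ⟩
        iter (suc t₀) n             ≡⟨ returns ⟩
        just n                      ∎
        where open ≡-Reasoning

    orbit-step : ∀ t → t ≤ t₀ → f (orbit t) ≡ just (orbit (suc t))
    orbit-step t t≤t₀ = begin
      f (orbit t)            ≡⟨ cong (_>>= f) (sym (orbit-defined t (m≤n⇒m≤1+n t≤t₀))) ⟩
      (iter t n >>= f)       ≡⟨ sym (iter-suc t n) ⟩
      iter (suc t) n         ≡⟨ orbit-defined (suc t) (s≤s t≤t₀) ⟩
      just (orbit (suc t))   ∎
      where open ≡-Reasoning

    periodic⇒cycle : Cycle n
    periodic⇒cycle = record
      { r        = t₀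
      ; point    = orbit ∘ toℕ
      ; starts   = refl
      ; distinct = λ {i} {j} → Fin.toℕ-injective ∘ injective (bound i) (bound j)
      ; step     = λ j → subst (λ t → f (orbit t) ≡ just (orbit (suc (toℕ j))))
                             (sym (Fin.toℕ-inject₁ j)) (orbit-step (toℕ j) (<⇒≤ (Fin.toℕ<n j)))
      ; wrap     = subst (λ t → f (orbit t) ≡ just n) (sym (Fin.toℕ-fromℕ t₀))
                     (trans (orbit-step t₀ ≤-refl) (trans (sym (orbit-defined (suc t₀) ≤-refl)) returns))
      }
      where
      bound : (i : Fin (suc t₀)) → toℕ i ≤ t₀
      bound i = s≤s⁻¹ (Fin.toℕ<n i)
      injective : ∀ {a b} → a ≤ t₀ → b ≤ t₀ → orbit a ≡ orbit b → a ≡ b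
      injective {a} {b} a≤ b≤ same with <-cmp a b
      ... | tri< a<b _ _ = ⊥-elim (orbit-injective a<b b≤ same)
      ... | tri≈ _ a≡b _ = a≡b
      ... | tri> _ _ b<a = ⊥-elim (orbit-injective b<a a≤ (sym same))

ℕ-step⇒ℤ : ∀ a w v l → w * a ≡ v + l → (+ a) *ℤ (+ w) ≡ (+ v) +ℤ (+ l)
ℕ-step⇒ℤ a w v l e = trans (sym (ℤ.pos-* a w)) (trans (cong +_ (trans (*-comm a w) e)) (ℤ.pos-+ v l))

ℤ-step⇒ℕ : ∀ a w v l → (+ a) *ℤ (+ w) ≡ (+ v) +ℤ (+ l) → w * a ≡ v + l
ℤ-step⇒ℕ a w v l e = trans (*-comm w a) (ℤ.+-injective (trans (ℤ.pos-* a w) (trans e (sym (ℤ.pos-+ v l)))))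

-- For a base g = h + 1 ≥ 2, an integer i with i ≤ g·i is a natural number
-- (a negative i would satisfy g·i < i).
below-scaling⇒natural : ∀ h i → 1 ≤ h → i ≤ℤ (+ suc h) *ℤ i → ∃ λ n → i ≡ + n
below-scaling⇒natural h (+ n) _ _ = n , refl
below-scaling⇒natural h -[1+ n ] h≥1 le = ⊥-elim (ℤ.<-irrefl refl (ℤ.<-≤-trans scaled< le))
  where
  scaled< : (+ suc h) *ℤ -[1+ n ] <ℤ -[1+ n ]
  scaled< = -<- (subst (_≤ n + h * suc n) (+-comm n 1) (+-monoʳ-≤ n (*-mono-≤ h≥1 (s≤s (z≤n {n})))))

above-natural⇒natural : ∀ {n i} → + n ≤ℤ i → ∃ λ k → i ≡ + k
above-natural⇒natural {i = + k} _ = k , refl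

-- A step v ↦ (v + l)/g needs g ∣ v + l; as g is even and d odd, at most one
-- digit l ∈ {0, d} works, so the steps of extreme cycles through naturals are
-- the steps of one partial map on ℕ.
module DigitMap (h d : ℕ) (g-even : 2 ∣ suc h) (d-odd : Odd d) where

  g : ℕ
  g = suc h

  digit : ℕ → ℕ
  digit v with g ∣? v
  ... | yes _ = 0
  ... | no _ = d

  digit≤d : ∀ v → digit v ≤ d
  digit≤d v with g ∣? v
  ... | yes _ = z≤n
  ... | no _ = ≤-refl

  next : ℕ → Maybe ℕ
  next v with g ∣? (v + digit v)
  ... | yes (divides q _) = just q
  ... | no _ = nothing

  digit-unique : ∀ {v w l} → l ≡ 0 ⊎ l ≡ d → w * g ≡ v + l → digit v ≡ l
  digit-unique {v} {w} (inj₁ refl) e with g ∣? v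
  ... | yes _ = refl
  ... | no g∤v = ⊥-elim (g∤v (divides w (trans (sym (+-identityʳ v)) (sym e))))
  digit-unique {v} {w} (inj₂ refl) e with g ∣? v
  ... | yes g∣v = ⊥-elim (odd⇒¬even d-odd (∣m+n∣m⇒∣n (∣-trans g-even (divides w (sym e))) (∣-trans g-even g∣v)))
  ... | no _ = refl

  next-sound : ∀ {v w} → next v ≡ just w → w * g ≡ v + digit v
  next-sound {v} eq with g ∣? (v + digit v)
  ... | yes (divides q e) = trans (cong (_* g) (sym (Maybe.just-injective eq))) (sym e)
  ... | no _ with eq
  ...   | ()

  next-complete : ∀ {v w l} → l ≡ 0 ⊎ l ≡ d → w * g ≡ v + l → next v ≡ just w
  next-complete {v} {w} l∈ e with digit-unique {v} {w} l∈ e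
  ... | refl with g ∣? (v + digit v)
  ...   | yes (divides q e′) = cong just (*-cancelʳ-≡ q w g (trans (sym e′) (sym e)))
  ...   | no g∤ = ⊥-elim (g∤ (divides w (sym e)))

  open PartialIteration next public

  iter-g^t : ∀ t v → iter t (g ^ t * v) ≡ just v
  iter-g^t zero v = cong just (+-identityʳ v)
  iter-g^t (suc t) v = trans (cong (_>>= iter t) divide) (iter-g^t t v)
    where
    divide : next (g * g ^ t * v) ≡ just (g ^ t * v)
    divide = next-complete (inj₁ refl)
      (trans (*-comm (g ^ t * v) g) (trans (sym (*-assoc g (g ^ t) v)) (sym (+-identityʳ _))))

  cycle⇒extreme : ∀ {n} → Cycle n → ExtremeCycle g d
  cycle⇒extreme C = record
    { r        = r
    ; x        = +_ ∘ point
    ; l        = +_ ∘ digit ∘ point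
    ; distinct = distinct ∘ ℤ.+-injective
    ; digits   = λ j → digit-values (point j)
    ; step     = λ j → sound-ℤ {point (inject₁ j)} (Cycle.step C j)
    ; wrap     = sound-ℤ {point (fromℕ r)} wrap
    }
    where
    open Cycle C hiding (step)
    sound-ℤ : ∀ {v w} → next v ≡ just w → (+ g) *ℤ (+ w) ≡ (+ v) +ℤ (+ digit v)
    sound-ℤ {v} {w} eq = ℕ-step⇒ℤ g w v (digit v) (next-sound eq)
    digit-values : ∀ v → (+ digit v ≡ + 0) ⊎ (+ digit v ≡ + d)
    digit-values v with g ∣? v
    ... | yes _ = inj₁ refl
    ... | no _ = inj₂ refl

  periodic⇒incomplete : ∀ {n k} → 1 ≤ n → iter (suc k) n ≡ just n → Incomplete g d
  periodic⇒incomplete {n} {k} n≥1 periodic =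
    cycle⇒extreme C , λ trivial → <⇒≢ n≥1 (sym (trans (sym starts) (ℤ.+-injective (trivial zero))))
    where
    C : Cycle n
    C = periodic⇒cycle _≟_ {n} {k} periodic
    open Cycle C

  module FromExtreme (h≥1 : 1 ≤ h) (C : ExtremeCycle g d) where
    open ExtremeCycle C

    predecessor : ∀ j → ∃ λ i → (+ g) *ℤ x j ≡ x i +ℤ l i
    predecessor zero = fromℕ r , wrap
    predecessor (suc j) = inject₁ j , ExtremeCycle.step C j

    natural-digit : ∀ j → ∃ λ L → l j ≡ + L × (L ≡ 0 ⊎ L ≡ d)
    natural-digit j with digits j
    ... | inj₁ e = 0 , e , inj₁ refl
    ... | inj₂ e = d , e , inj₂ refl

    -- The least element x_m satisfies g·x_m = x_i + l_i ≥ x_m, hence x_m ≥ 0.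
    lowest : ∃ λ m → ∀ i → x m ≤ℤ x i
    lowest = argmax (Flip.totalPreorder ℤ.≤-totalPreorder) x

    lowest-below-scaling : x (proj₁ lowest) ≤ℤ (+ g) *ℤ x (proj₁ lowest)
    lowest-below-scaling = begin
      x m           ≤⟨ proj₂ lowest i ⟩
      x i           ≤⟨ ℤ.i≤i+j (x i) (+ L) ⟩
      x i +ℤ + L    ≡⟨ cong (x i +ℤ_) (sym (proj₁ (proj₂ (natural-digit i)))) ⟩
      x i +ℤ l i    ≡⟨ sym (proj₂ (predecessor m)) ⟩
      (+ g) *ℤ x m  ∎
      where
      open ℤ.≤-Reasoning
      m i : Fin (suc r)
      m = proj₁ lowest
      i = proj₁ (predecessor m)
      L : ℕ
      L = proj₁ (natural-digit i)

    natural : ∀ j → ∃ λ n → x j ≡ + n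
    natural j with below-scaling⇒natural h _ h≥1 lowest-below-scaling
    ... | n , eq = above-natural⇒natural (subst (_≤ℤ x j) eq (proj₂ lowest j))

    value : Fin (suc r) → ℕ
    value j = proj₁ (natural j)

    x≡value : ∀ j → x j ≡ + value j
    x≡value j = proj₂ (natural j)

    extreme-step⇒next : ∀ {j i} → (+ g) *ℤ x j ≡ x i +ℤ l i → next (value i) ≡ just (value j)
    extreme-step⇒next {j} {i} e = next-complete (proj₂ (proj₂ (natural-digit i))) (ℤ-step⇒ℕ g (value j) (value i) L in-ℕ)
      where
      L : ℕ
      L = proj₁ (natural-digit i)
      in-ℕ : (+ g) *ℤ (+ value j) ≡ (+ value i) +ℤ (+ L)
      in-ℕ = begin
        (+ g) *ℤ (+ value j)  ≡⟨ cong ((+ g) *ℤ_) (sym (x≡value j)) ⟩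
        (+ g) *ℤ x j          ≡⟨ e ⟩
        x i +ℤ l i            ≡⟨ cong₂ _+ℤ_ (x≡value i) (proj₁ (proj₂ (natural-digit i))) ⟩
        (+ value i) +ℤ (+ L)  ∎
        where open ≡-Reasoning

    extreme⇒cycle : Cycle (value zero)
    extreme⇒cycle = record
      { r        = r
      ; point    = value
      ; starts   = refl
      ; distinct = λ {i} {j} e → distinct (trans (x≡value i) (trans (cong +_ e) (sym (x≡value j))))
      ; step     = λ j → extreme-step⇒next (ExtremeCycle.step C j)
      ; wrap     = extreme-step⇒next wrap
      }

    -- The largest element x_M satisfies g·x_M = x_i + l_i ≤ x_M + d, hence h·x_M ≤ d.
    value-bound : ∀ j → h * value j ≤ d
    value-bound j = ≤-trans (*-monoʳ-≤ h (proj₂ highest j)) (+-cancelˡ-≤ (value M) (h * value M) d (begin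
      value M + h * value M   ≡⟨ *-comm g (value M) ⟩
      value M * g             ≡⟨ next-sound (extreme-step⇒next (proj₂ (predecessor M))) ⟩
      value i + digit (value i) ≤⟨ +-mono-≤ (proj₂ highest i) (digit≤d (value i)) ⟩
      value M + d             ∎))
      where
      open ≤-Reasoning
      highest : ∃ λ M → ∀ j → value j ≤ value M
      highest = argmax ≤-totalPreorder value
      M i : Fin (suc r)
      M = proj₁ highest
      i = proj₁ (predecessor M)

    value≤d : ∀ j → value j ≤ d
    value≤d j = ≤-trans (m≤n*m (value j) h {{>-nonZero h≥1}}) (value-bound j)

    -- Distinct values in [0, d] can be at most d + 1 in number.
    length-bound : r ≤ d
    length-bound = s≤s⁻¹ (Fin.injective⇒≤ {f = λ j → fromℕ< (s≤s (value≤d j))}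
      (λ {i} {j} e → extreme⇒cycle .Cycle.distinct (Fin.fromℕ<-injective (value i) (value j) _ _ e)))

    -- 0 is a fixed point of the digit map, so a cycle meeting 0 is {0}.
    trivial-if-zero : value zero ≡ 0 → Trivial C
    trivial-if-zero start0 j = trans (x≡value j) (cong +_ (Maybe.just-injective (begin
      just (value j)         ≡⟨ sym (cycle-orbit extreme⇒cycle j) ⟩
      iter (toℕ j) (value zero) ≡⟨ cong (iter (toℕ j)) start0 ⟩
      iter (toℕ j) 0         ≡⟨ zero-fixed (toℕ j) ⟩
      just 0                 ∎)))
      where
      open ≡-Reasoning
      zero-fixed : ∀ t → iter t 0 ≡ just 0
      zero-fixed zero = refl
      zero-fixed (suc t) rewrite next-complete {0} {0} (inj₁ refl) refl = zero-fixed t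

  ShortReturn : ℕ → Set
  ShortReturn a = 1 ≤ a × ∃ λ b → b < suc d × iter (suc b) a ≡ just a

  short-return? : ∀ a → Dec (ShortReturn a)
  short-return? a = (1 ≤? a) ×-dec anyUpTo? (λ b → Maybe.≡-dec _≟_ (iter (suc b) a) (just a)) (suc d)

  -- Completeness is decidable: by the bounds above, a nontrivial extreme
  -- cycle exists iff some a ≤ d is a short return.
  complete-or-incomplete : 1 ≤ h → Complete g d ⊎ Incomplete g d
  complete-or-incomplete h≥1 with anyUpTo? short-return? (suc d)
  ... | yes (a , _ , 1≤a , b , _ , periodic) = inj₂ (periodic⇒incomplete {a} {b} 1≤a periodic)
  ... | no none = inj₁ complete
    where
    complete : Complete g d
    complete C with FromExtreme.value h≥1 C zero ≟ 0
    ... | yes start≡0 = FromExtreme.trivial-if-zero h≥1 C start≡0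
    ... | no start≢0 = ⊥-elim (none (value zero , s≤s (value≤d zero) , n≢0⇒n>0 start≢0 ,
                                    ExtremeCycle.r C , s≤s length-bound , cycle⇒periodic extreme⇒cycle))
      where open FromExtreme h≥1 C

-- For even g ≥ 4 the digit set {0, 1} admits only the trivial extreme cycle,
-- since all its elements v satisfy (g - 1)·v ≤ 1.
one-complete : ∀ h → 2 ≤ h → 2 ∣ suc h → Complete (suc h) 1
one-complete h 2≤h g-even C = trivial-if-zero (small (value zero) (value-bound zero))
  where
  open DigitMap h 1 g-even refl
  open FromExtreme (≤-trans (s≤s z≤n) 2≤h) C
  small : ∀ v → h * v ≤ 1 → v ≡ 0
  small zero _ = refl
  small (suc v) hv≤1 with ≤-trans 2≤h (≤-trans (m≤m*n h (suc v)) hv≤1)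
  ... | s≤s ()

-- Repunits in base g = h + 1:  G n = 1 + g + ⋯ + g^(n-1) = (gⁿ - 1)/h.
-- The auxiliary T n = Σ_{i<n} (n-1-i)·gⁱ records that G n ≡ n (mod h).
module Repunit (h : ℕ) where
  open +-*-Solver

  g : ℕ
  g = suc h

  G : ℕ → ℕ
  G zero = 0
  G (suc n) = 1 + g * G n

  T : ℕ → ℕ
  T zero = 0
  T (suc n) = n + g * T n

  G≡n+hT : ∀ n → G n ≡ n + h * T n
  G≡n+hT zero = sym (*-zeroʳ h)
  G≡n+hT (suc n) rewrite G≡n+hT n =
    solve 3 (λ n h t → con 1 :+ (con 1 :+ h) :* (n :+ h :* t) := (con 1 :+ n) :+ h :* (n :+ (con 1 :+ h) :* t)) refl n h (T n)

  g^n≡1+hG : ∀ n → g ^ n ≡ 1 + h * G n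
  g^n≡1+hG zero = cong suc (sym (*-zeroʳ h))
  g^n≡1+hG (suc n) rewrite g^n≡1+hG n =
    solve 2 (λ h x → (con 1 :+ h) :* (con 1 :+ h :* x) := con 1 :+ h :* (con 1 :+ (con 1 :+ h) :* x)) refl h (G n)

  G-+ : ∀ a b → G (a + b) ≡ G a + g ^ a * G b
  G-+ zero b = sym (+-identityʳ (G b))
  G-+ (suc a) b rewrite G-+ a b =
    solve 4 (λ g x p y → con 1 :+ g :* (x :+ p :* y) := (con 1 :+ g :* x) :+ g :* p :* y) refl g (G a) (g ^ a) (G b)

  G-suc : ∀ n → G (suc n) ≡ G n + g ^ n
  G-suc n = begin
    G (suc n)           ≡⟨ cong G (+-comm 1 n) ⟩
    G (n + 1)           ≡⟨ G-+ n 1 ⟩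
    G n + g ^ n * G 1   ≡⟨ cong (λ k → G n + g ^ n * suc k) (*-zeroʳ g) ⟩
    G n + g ^ n * 1     ≡⟨ cong (λ k → G n + k) (*-identityʳ (g ^ n)) ⟩
    G n + g ^ n         ∎
    where open ≡-Reasoning

  G-odd : 2 ∣ g → ∀ n → Odd (G (suc n))
  G-odd (divides q g≡q2) n = begin
    suc (g * G n) % 2           ≡⟨ cong (λ k → suc k % 2) (cong (_* G n) g≡q2) ⟩
    suc (q * 2 * G n) % 2       ≡⟨ cong (λ k → suc k % 2) (solve 2 (λ q x → q :* con 2 :* x := q :* x :* con 2) refl q (G n)) ⟩
    suc (q * G n * 2) % 2       ≡⟨ [m+kn]%n≡m%n 1 (q * G n) 2 ⟩
    1                           ∎
    where open ≡-Reasoning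

-- The explicit cycle for the digit set {0, M} with M = G r, r = s + h:
-- the numbers X u = (g^(r-u)·G u + G (h-u))/h, 0 ≤ u ≤ h, satisfy
-- g·X (u+1) = X u + M, X 0 = 1 + T h and X h = gˢ·X 0.  So starting from
-- gˢ·X 0, s divisions by g lead to X 0, and h steps with digit M lead back.
module RepunitCycle (h s : ℕ) (h≥1 : 1 ≤ h) where
  open Repunit h
  open +-*-Solver

  instance
    h-nonzero : NonZero h
    h-nonzero = >-nonZero h≥1

  r : ℕ
  r = s + h

  M : ℕ
  M = G r

  X : ℕ → ℕ
  X u = 1 + T u + G (r ∸ u) * G u + T (h ∸ u)

  W : ℕ → ℕ
  W u = g ^ (r ∸ u) * G u + G (h ∸ u)

  h*X-split : ∀ u e → h ≡ u + e → h * (1 + T u + G (s + e) * G u + T e) ≡ g ^ (s + e) * G u + G e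
  h*X-split u e h≡u+e rewrite g^n≡1+hG (s + e) | G≡n+hT u | G≡n+hT e = expand h u e (T u) (T e) (G (s + e)) h≡u+e
    where
    expand : ∀ H u e tu te gs → H ≡ u + e →
                H * (1 + tu + gs * (u + H * tu) + te) ≡ (1 + H * gs) * (u + H * tu) + (e + H * te)
    expand .(u + e) u e tu te gs refl =
      solve 5 (λ u e tu te gs → (u :+ e) :* (con 1 :+ tu :+ gs :* (u :+ (u :+ e) :* tu) :+ te)
                := (con 1 :+ (u :+ e) :* gs) :* (u :+ (u :+ e) :* tu) :+ (e :+ (u :+ e) :* te))
      refl u e tu te gs

  h*X≡W : ∀ u → u ≤ h → h * X u ≡ W u
  h*X≡W u u≤h = subst₂ (λ p q → h * (1 + T u + G p * G u + T (h ∸ u)) ≡ g ^ p * G u + G (h ∸ u))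
                  (sym (+-∸-assoc s u≤h)) (sym (+-∸-assoc s u≤h))
                  (h*X-split u (h ∸ u) (sym (m+[n∸m]≡n u≤h)))

  -- The recurrence, multiplied by h: g·W (u+1) = W u + h·M, using g^r = 1 + h·M.
  g*W-step : ∀ u a → h ≡ suc u + a →
             g * (g ^ (s + a) * G (suc u) + G a) ≡ (g ^ (s + suc a) * G u + G (suc a)) + h * M
  g*W-step u a h≡ = begin
    g * (g ^ (s + a) * G (suc u) + G a)
      ≡⟨ cong (λ z → g * (g ^ (s + a) * z + G a)) (G-suc u) ⟩
    g * (g ^ (s + a) * (G u + g ^ u) + G a)
      ≡⟨ solve 5 (λ g p gu q ga → g :* (p :* (gu :+ q) :+ ga) := (g :* p) :* gu :+ (g :* p) :* q :+ g :* ga)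
                 refl g (g ^ (s + a)) (G u) (g ^ u) (G a) ⟩
    (g * g ^ (s + a)) * G u + (g * g ^ (s + a)) * g ^ u + g * G a
      ≡⟨ cong (λ z → z * G u + z * g ^ u + g * G a) (cong (g ^_) (sym (+-suc s a))) ⟩
    P * G u + P * g ^ u + g * G a
      ≡⟨ cong (λ z → P * G u + z + g * G a) P*g^u ⟩
    P * G u + (1 + h * M) + g * G a
      ≡⟨ solve 5 (λ p gu hm g ga → p :* gu :+ (con 1 :+ hm) :+ g :* ga := (p :* gu :+ (con 1 :+ g :* ga)) :+ hm)
                 refl P (G u) (h * M) g (G a) ⟩
    (P * G u + G (suc a)) + h * M
      ∎
    where
    open ≡-Reasoning
    P : ℕ
    P = g ^ (s + suc a)
    exponent : s + suc a + u ≡ r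
    exponent = trans (+-assoc s (suc a) u) (cong (λ k → s + k) (trans (+-comm (suc a) u) (trans (+-suc u a) (sym h≡))))
    P*g^u : P * g ^ u ≡ 1 + h * M
    P*g^u = trans (sym (^-distribˡ-+-* g (s + suc a) u)) (trans (cong (g ^_) exponent) (g^n≡1+hG r))

  X-step : ∀ u → u < h → X (suc u) * g ≡ X u + M
  X-step u u<h = *-cancelˡ-≡ (X (suc u) * g) (X u + M) h (begin
    h * (X (suc u) * g)                           ≡⟨ solve 3 (λ h g x → h :* (x :* g) := g :* (h :* x)) refl h g (X (suc u)) ⟩
    g * (h * X (suc u))                           ≡⟨ cong (g *_) (h*X≡W (suc u) u<h) ⟩
    g * W (suc u)                                 ≡⟨ cong (λ p → g * (g ^ p * G (suc u) + G a)) (+-∸-assoc s u<h) ⟩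
    g * (g ^ (s + a) * G (suc u) + G a)           ≡⟨ g*W-step u a h≡ ⟩
    (g ^ (s + suc a) * G u + G (suc a)) + h * M   ≡⟨ cong₂ (λ p q → (g ^ p * G u + G q) + h * M) (sym r∸u) (sym h∸u) ⟩
    W u + h * M                                   ≡⟨ cong (_+ h * M) (sym (h*X≡W u (<⇒≤ u<h))) ⟩
    h * X u + h * M                               ≡⟨ sym (*-distribˡ-+ h (X u) M) ⟩
    h * (X u + M)                                 ∎)
    where
    open ≡-Reasoning
    a : ℕ
    a = h ∸ suc u
    h≡ : h ≡ suc u + a
    h≡ = sym (m+[n∸m]≡n u<h)
    h∸u : h ∸ u ≡ suc a
    h∸u = trans (cong (_∸ u) (trans h≡ (sym (+-suc u a)))) (m+n∸m≡n u (suc a))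
    r∸u : r ∸ u ≡ s + suc a
    r∸u = trans (+-∸-assoc s (<⇒≤ u<h)) (cong (λ k → s + k) h∸u)

  X₀ : ℕ
  X₀ = 1 + T h

  X-start : X 0 ≡ X₀
  X-start = cong (λ z → suc (z + T h)) (*-zeroʳ (G r))

  X-end : X h ≡ g ^ s * X₀
  X-end = begin
    1 + T h + G (r ∸ h) * G h + T (h ∸ h)    ≡⟨ cong₂ (λ p q → 1 + T h + G p * G h + T q) (m+n∸n≡m s h) (n∸n≡0 h) ⟩
    1 + T h + G s * G h + 0                  ≡⟨ cong (λ z → 1 + T h + G s * z + 0) (G≡n+hT h) ⟩
    1 + T h + G s * (h + h * T h) + 0        ≡⟨ solve 3 (λ t gs h → con 1 :+ t :+ gs :* (h :+ h :* t) :+ con 0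
                                                             := (con 1 :+ h :* gs) :* (con 1 :+ t))
                                                         refl (T h) (G s) h ⟩
    (1 + h * G s) * X₀                       ≡⟨ cong (_* X₀) (sym (g^n≡1+hG s)) ⟩
    g ^ s * X₀                               ∎
    where open ≡-Reasoning

  M-incomplete : (g-even : 2 ∣ g) (M-odd : Odd M) → Incomplete g M
  M-incomplete g-even M-odd = periodic⇒incomplete {n₀} {s + pred h} n₀≥1 periodic
    where
    open DigitMap h M g-even M-odd hiding (g)
    n₀ : ℕ
    n₀ = g ^ s * X₀
    n₀≥1 : 1 ≤ n₀
    n₀≥1 = *-mono-≤ (m^n>0 g s) (s≤s (z≤n {T h}))
    round-trip : iter (s + h) n₀ ≡ just n₀
    round-trip = begin
      iter (s + h) n₀        ≡⟨ iter-+ s h n₀ ⟩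
      (iter s n₀ >>= iter h) ≡⟨ cong (_>>= iter h) (iter-g^t s X₀) ⟩
      iter h X₀              ≡⟨ cong (iter h) (sym X-start) ⟩
      iter h (X 0)           ≡⟨ iter-chain h X (λ u u<h → next-complete (inj₂ refl) (X-step u u<h)) ⟩
      just (X h)             ≡⟨ cong just X-end ⟩
      just n₀                ∎
      where open ≡-Reasoning
    periodic : iter (suc (s + pred h)) n₀ ≡ just n₀
    periodic = subst (λ k → iter k n₀ ≡ just n₀) (trans (cong (λ k → s + k) (sym (suc-pred h))) (+-suc s (pred h))) round-trip

repunit-incomplete : ∀ h r → 1 ≤ h → h ≤ r → 2 ∣ suc h → Incomplete (suc h) (Repunit.G h r)
repunit-incomplete h r h≥1 h≤r g-even =
  subst (Incomplete g ∘ G) r-split (M-incomplete g-even (subst (Odd ∘ G) (sym r-split) G-r-odd))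
  where
  open Repunit h
  open RepunitCycle h (r ∸ h) h≥1 using (M-incomplete)
  instance
    r-nonzero : NonZero r
    r-nonzero = >-nonZero (≤-trans h≥1 h≤r)
  r-split : r ∸ h + h ≡ r
  r-split = m∸n+n≡m h≤r
  G-r-odd : Odd (G r)
  G-r-odd = subst (Odd ∘ G) (suc-pred r) (G-odd g-even (pred r))

equal-remainders⇒∣ : ∀ x y e .{{_ : NonZero e}} → x % e ≡ (x + y) % e → e ∣ y
equal-remainders⇒∣ x y e eq = ∣m+n∣m⇒∣n (divides ((x + y) / e) quotients) (n∣m*n (x / e))
  where
  quotients : x / e * e + y ≡ (x + y) / e * e
  quotients = +-cancelˡ-≡ (x % e) _ _ (begin
    x % e + (x / e * e + y)        ≡⟨ sym (+-assoc (x % e) _ y) ⟩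
    x % e + x / e * e + y          ≡⟨ cong (_+ y) (sym (m≡m%n+[m/n]*n x e)) ⟩
    x + y                          ≡⟨ m≡m%n+[m/n]*n (x + y) e ⟩
    (x + y) % e + (x + y) / e * e  ≡⟨ cong (_+ (x + y) / e * e) (sym eq) ⟩
    x % e + (x + y) / e * e        ∎)
    where open ≡-Reasoning

∣! : ∀ {a K} → 1 ≤ a → a ≤ K → a ∣ K !
∣! {suc a} _ a≤K = ∣-trans (m∣m*n (a !)) (m≤n⇒m!∣n! a≤K)

n≤n! : ∀ n → n ≤ n !
n≤n! zero = z≤n
n≤n! (suc n) = ∣⇒≤ {{suc n !≢0}} (∣! (s≤s z≤n) ≤-refl)

-- Every divisor e > 1 of the repunit G (K! + 1) exceeds K.  Otherwise the
-- multiplicative period a ≤ e of g modulo e divides K!, so g^(K!) ≡ 1 and,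
-- with e ∣ G (K! + 1), e ∣ G 1·h = h; as G r ≡ r (mod h) this gives
-- e ∣ K! + 1, while e ≤ K gives e ∣ K!.
module RepunitDivisors (h K e : ℕ) (1<e : 1 < e) where
  open Repunit h
  open +-*-Solver

  r : ℕ
  r = suc (K !)

  instance
    e-nonzero : NonZero e
    e-nonzero = >-nonZero (<-trans z<s 1<e)

  module _ (e∣G : e ∣ G r) where

    -- G r = 1 + g·G (K!), so e is coprime to g.
    coprime : Coprime e g
    coprime {c} (c∣e , c∣g) = ∣1⇒≡1 (∣m+n∣m⇒∣n (subst (c ∣_) (+-comm 1 (g * G (K !))) (∣-trans c∣e e∣G))
                                              (∣-trans c∣g (m∣m*n (G (K !)))))

    cancel-g^ : ∀ i y → e ∣ g ^ i * y → e ∣ y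
    cancel-g^ zero y p = subst (e ∣_) (+-identityʳ y) p
    cancel-g^ (suc i) y p = cancel-g^ i y (coprime-divisor coprime (subst (e ∣_) (*-assoc g (g ^ i) y) p))

    -- a is a period of n ↦ gⁿ mod e:  e ∣ gᵃ - 1 = h·G a.
    Period : ℕ → Set
    Period a = e ∣ h * G a

    h*G-+ : ∀ b c → h * G (b + c) ≡ h * G b + g ^ b * (h * G c)
    h*G-+ b c rewrite G-+ b c =
      solve 4 (λ h x p y → h :* (x :+ p :* y) := h :* x :+ p :* (h :* y)) refl h (G b) (g ^ b) (G c)

    period-∸ : ∀ b c → Period b → Period (b + c) → Period c
    period-∸ b c pb pbc = cancel-g^ b (h * G c) (∣m+n∣m⇒∣n (subst (e ∣_) (h*G-+ b c) pbc) pb)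

    period-* : ∀ a q → Period a → Period (q * a)
    period-* a zero _ = subst (e ∣_) (sym (*-zeroʳ h)) (e ∣0)
    period-* a (suc q) pa = subst (e ∣_) (sym (h*G-+ a (q * a))) (∣m∣n⇒∣m+n pa (∣n⇒∣m*n (g ^ a) (period-* a q pa)))

    -- Among g⁰, …, gᵉ two powers gⁱ, gʲ (i < j) agree modulo e; then j - i is a period.
    small-period : ∃ λ a → 1 ≤ a × a ≤ e × Period a
    small-period with Fin.pigeonhole (n<1+n e) (λ i → fromℕ< (m%n<n (g ^ toℕ i) e))
    ... | i , j , i<j , same = j′ ∸ i′ , m<n⇒0<n∸m i<j , ≤-trans (m∸n≤m j′ i′) (s≤s⁻¹ (Fin.toℕ<n j)) , period
      where
      i′ j′ a : ℕ
      i′ = toℕ i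
      j′ = toℕ j
      a = j′ ∸ i′
      g^j : g ^ j′ ≡ g ^ i′ + g ^ i′ * (h * G a)
      g^j = begin
        g ^ j′                      ≡⟨ cong (g ^_) (sym (m+[n∸m]≡n (<⇒≤ i<j))) ⟩
        g ^ (i′ + a)                ≡⟨ ^-distribˡ-+-* g i′ a ⟩
        g ^ i′ * g ^ a              ≡⟨ cong (g ^ i′ *_) (g^n≡1+hG a) ⟩
        g ^ i′ * (1 + h * G a)      ≡⟨ solve 2 (λ p x → p :* (con 1 :+ x) := p :+ p :* x) refl (g ^ i′) (h * G a) ⟩
        g ^ i′ + g ^ i′ * (h * G a) ∎
        where open ≡-Reasoning
      period : Period a
      period = cancel-g^ i′ (h * G a) (equal-remainders⇒∣ (g ^ i′) (g ^ i′ * (h * G a)) e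
                 (trans (Fin.fromℕ<-injective _ _ (m%n<n (g ^ i′) e) (m%n<n (g ^ j′) e) same) (cong (_% e) g^j)))

    divisor-large : K < e
    divisor-large with K <? e
    ... | yes K<e = K<e
    ... | no K≮e = ⊥-elim (<⇒≢ 1<e (sym (∣1⇒≡1 (e∣1 (≮⇒≥ K≮e)))))
      where
      e∣1 : e ≤ K → e ∣ 1
      e∣1 e≤K with small-period
      ... | a , a≥1 , a≤e , pa = ∣m+n∣m⇒∣n (subst (e ∣_) (+-comm 1 (K !)) e∣r) (∣! (<⇒≤ 1<e) e≤K)
        where
        period-K! : Period (K !)
        period-K! with ∣! a≥1 (≤-trans a≤e e≤K)
        ... | divides q K!≡q*a = subst Period (sym K!≡q*a) (period-* a q pa)
        period-r : Period r
        period-r = ∣n⇒∣m*n h e∣G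
        e∣h : e ∣ h
        e∣h = subst (e ∣_) (trans (cong (h *_) (cong suc (*-zeroʳ g))) (*-identityʳ h))
                (period-∸ (K !) 1 period-K! (subst Period (+-comm 1 (K !)) period-r))
        e∣r : e ∣ r
        e∣r = ∣m+n∣m⇒∣n (subst (e ∣_) (trans (G≡n+hT r) (+-comm r (h * T r))) e∣G) (∣m⇒∣m*n (T r) e∣h)

complete⇒¬incomplete : ∀ {g d} → Complete g d → ¬ Incomplete g d
complete⇒¬incomplete complete (C , nontrivial) = nontrivial (complete C)

module OddDivisors (h : ℕ) (h≥1 : 1 ≤ h) (g-even : 2 ∣ suc h) {m : ℕ} (m-odd : Odd m) where

  decide : ∀ d → d ∣ m → Complete (suc h) d ⊎ Incomplete (suc h) d
  decide d d∣m = DigitMap.complete-or-incomplete h d g-even (odd-divisor d∣m m-odd) h≥1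

  incomplete-divisor? : ∀ d → Dec (d ∣ m × Incomplete (suc h) d)
  incomplete-divisor? d with d ∣? m
  ... | no d∤m = no (d∤m ∘ proj₁)
  ... | yes d∣m with decide d d∣m
  ...   | inj₁ complete = no (complete⇒¬incomplete complete ∘ proj₂)
  ...   | inj₂ incomplete = yes (d∣m , incomplete)

  -- If m > 0 is incomplete, its least incomplete divisor is primitive:
  -- all smaller divisors are complete by minimality.
  primitive-divisor : 0 < m → Incomplete (suc h) m → ∃ λ p → p ∣ m × Primitive (suc h) p
  primitive-divisor m>0 m-incomplete with least-witness incomplete-divisor? {m} (∣-refl , m-incomplete)
  ... | p , (p∣m , p-incomplete) , below-complete =
    p , p∣m , odd-divisor p∣m m-odd , p-incomplete , proper-divisors-complete
    where
    instance
      p-nonzero : NonZero p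
      p-nonzero = ≢-nonZero λ p≡0 → <⇒≢ m>0 (sym (0∣⇒≡0 (subst (_∣ m) p≡0 p∣m)))
    proper-divisors-complete : ∀ e → e ∣ p → e ≢ p → Complete (suc h) e
    proper-divisors-complete e e∣p e≢p with decide e (∣-trans e∣p p∣m)
    ... | inj₁ complete = complete
    ... | inj₂ incomplete = ⊥-elim (below-complete e (≤∧≢⇒< (∣⇒≤ e∣p) e≢p) (∣-trans e∣p p∣m , incomplete))

incomplete-divisor>1 : ∀ h {p m} → 2 ≤ h → 2 ∣ suc h → 0 < m → p ∣ m → Incomplete (suc h) p → 1 < p
incomplete-divisor>1 h {zero} _ _ m>0 0∣m _ = ⊥-elim (<⇒≢ m>0 (sym (0∣⇒≡0 0∣m)))
incomplete-divisor>1 h {1} 2≤h g-even _ _ incomplete = ⊥-elim (complete⇒¬incomplete (one-complete h 2≤h g-even) incomplete)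
incomplete-divisor>1 h {suc (suc p)} _ _ _ _ _ = s≤s (s≤s z≤n)

theorem2p17 : ∀ (g : ℕ) → 4 ≤ g → 2 ∣ g →
    ∀ (N : ℕ) → ∃ λ m → N ≤ m × Primitive g m
theorem2p17 (suc h) (s≤s 3≤h) g-even N =
  let p , p∣M , p-primitive = OddDivisors.primitive-divisor h h≥1 g-even M-odd z<s M-incomplete
      p>1 : 1 < p
      p>1 = incomplete-divisor>1 h h≥2 g-even z<s p∣M (proj₁ (proj₂ p-primitive))
  in  p , ≤-trans (m≤m+n N h) (<⇒≤ (RepunitDivisors.divisor-large h K p p>1 p∣M)) , p-primitive
  where
  open Repunit h using (G; G-odd)
  h≥2 : 2 ≤ h
  h≥2 = ≤-trans (s≤s (s≤s z≤n)) 3≤h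
  h≥1 : 1 ≤ h
  h≥1 = ≤-trans (s≤s z≤n) h≥2
  K : ℕ
  K = N + h
  M : ℕ
  M = G (suc (K !))
  M-odd : Odd M
  M-odd = G-odd g-even (K !)
  M-incomplete : Incomplete (suc h) M
  M-incomplete = repunit-incomplete h (suc (K !)) h≥1 (m≤n⇒m≤1+n (≤-trans (m≤n+m h N) (n≤n! K))) g-even
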